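{- Let $\mathcal{F} \subset \mathcal{P}([n])$ be an $r$-closed $\theta$-intersecting family, where $r \geq 3$ and $\theta \in (0,1)$. Suppose $S_{\mathrm{nor}} \neq \emptyset$. Let $i \in S_{\mathrm{exc}}$ with $i > i_{\max}$. If $\mathcal{F}(i) = \{A\}$, then $\mathrm{core}(\mathcal{F}(i_{\max})) \subseteq A$.
   Context: A family $\mathcal{F} \subset \mathcal{P}([n])$ is $r$-closed $\theta$-intersecting if for each $2 \leq t \leq r$ and any $t$ distinct sets $A_1,\dots,A_t \in \mathcal{F}$ we have $|A_1 \cap \dots \cap A_t| \in \{\theta|A_1|, \dots, \theta|A_t|\}$. $\mathcal{F}(i) := \mathcal{F} \cap \binom{[n]}{i}$. For $A \in \mathcal{F}$, $\mathrm{Tor}(A) := \{B \in \mathcal{F} : |B| \geq |A|,\ |A \cap B| = \theta|A|\}$. When $\mathrm{Tor}(A) \neq \emptyset$, $\mathrm{core}(A) := A \cap B$ for any $B \in \mathrm{Tor}(A)$ (independent of the choice of $B$). $S := \{i \in [n] : \mathcal{F}(i) \neq \emptyset\}$, $S_{\mathrm{nor}} := \{i \in S : \mathrm{Tor}(A) \neq \emptyset \text{ for all } A \in \mathcal{F}(i)\}$, $S_{\mathrm{exc}} := S \setminus S_{\mathrm{nor}}$, $i_{\max} := \max S_{\mathrm{nor}}$. For $i \in S_{\mathrm{nor}}$, all sets in $\mathcal{F}(i)$ have the same core, denoted $\mathrm{core}(\mathcal{F}(i))$.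
   Formalization: The parameter θ ranges only over the rationals in (0,1), given as a fraction p/q of natural numbers with 0 < p < q. -}

module Defs where

open import Data.Nat using (ℕ; _*_; _≤_; _<_; _≥_)
open import Data.Fin using (Fin)
open import Data.Fin.Subset using (Subset; _∩_; ⋂; ∣_∣; _⊆_)
open import Data.List using (tabulate)
open import Data.Product using (Σ; ∃; _×_)
open import Relation.Nullary using (¬_)
open import Relation.Binary.PropositionalEquality using (_≡_)
open import Function.Definitions using (Injective)

Family : ℕ → Set₁
Family n = Subset n → Set

-- θ is represented as the fraction p / q (0 < p < q); "|X| = θ|Y|" is q * |X| ≡ p * |Y|.

⋂ᶠ : ∀ {n t} → (Fin t → Subset n) → Subset n
⋂ᶠ As = ⋂ (tabulate As)

RClosedIntersecting : ∀ {n} → ℕ → ℕ → ℕ → Family n → Set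
RClosedIntersecting {n} r p q F =
  ∀ (t : ℕ) → 2 ≤ t → t ≤ r →
  (As : Fin t → Subset n) → Injective _≡_ _≡_ As → (∀ j → F (As j)) →
  ∃ λ (j : Fin t) → q * ∣ ⋂ᶠ As ∣ ≡ p * ∣ As j ∣

InTor : ∀ {n} → ℕ → ℕ → Family n → Subset n → Subset n → Set
InTor p q F A B = F B × ∣ B ∣ ≥ ∣ A ∣ × q * ∣ A ∩ B ∣ ≡ p * ∣ A ∣

InS : ∀ {n} → Family n → ℕ → Set
InS {n} F i = 1 ≤ i × i ≤ n × ∃ λ A → F A × ∣ A ∣ ≡ i

InSnor : ∀ {n} → ℕ → ℕ → Family n → ℕ → Set
InSnor p q F i = InS F i × (∀ A → F A → ∣ A ∣ ≡ i → ∃ λ B → InTor p q F A B)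

InSexc : ∀ {n} → ℕ → ℕ → Family n → ℕ → Set
InSexc p q F i = InS F i × ¬ InSnor p q F i

IsMaxSnor : ∀ {n} → ℕ → ℕ → Family n → ℕ → Set
IsMaxSnor p q F m = InSnor p q F m × (∀ j → InSnor p q F j → j ≤ m)

IsSingletonLevel : ∀ {n} → Family n → ℕ → Subset n → Set
IsSingletonLevel F i A = F A × ∣ A ∣ ≡ i × (∀ B → F B → ∣ B ∣ ≡ i → B ≡ A)

{-# OPTIONS --safe #-}
-- A torsion partner B of A′ differs from A′ since θ < 1, and so does any member C of the family
-- larger than A′. If also B ≠ C, 3-closedness makes q|A′ ∩ B ∩ C| equal to p times the size of
-- one of A′, B, C, hence at least p|A′| = q|A′ ∩ B|; so intersecting the core A′ ∩ B with C
-- loses nothing, i.e. the core lies in C.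
module Submission where

open import Defs
open import Data.Nat using (ℕ; >-nonZero; _≤_; _<_; _*_; s≤s; z≤n)
open import Data.Nat.Properties
  using (≤-refl; ≤-trans; ≤-reflexive; <⇒≤; <⇒≢; <⇒≱; ≤-<-trans; *-monoʳ-≤; *-monoˡ-<; *-cancelˡ-≤; module ≤-Reasoning)
open import Data.Fin using (Fin)
open import Data.Fin.Patterns using (0F; 1F; 2F)
open import Data.Fin.Subset using (Subset; _∩_; ∣_∣; _⊆_; _⊂_)
open import Data.Fin.Subset.Properties
  using (_∈?_; p⊂q⇒∣p∣<∣q∣; ∩-assoc; ∩-idem; ∩-identityʳ; p∩q⊆p; p∩q⊆q; x∈p∩q⁻)
open import Data.Bool.Properties using () renaming (_≟_ to _≟ᵇ_)
open import Data.Vec.Properties using (≡-dec)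
open import Data.Empty using (⊥-elim)
open import Data.Product using (∃; _,_; proj₂)
open import Function.Definitions using (Injective)
open import Relation.Nullary using (yes; no)
open import Relation.Binary.PropositionalEquality using (_≡_; _≢_; refl; sym; trans; cong)

∣p∣≤∣p∩q∣⇒p⊆q : ∀ {n} (p q : Subset n) → ∣ p ∣ ≤ ∣ p ∩ q ∣ → p ⊆ q
∣p∣≤∣p∩q∣⇒p⊆q p q ∣p∣≤∣p∩q∣ {x} x∈p with x ∈? q
... | yes x∈q = x∈q
... | no x∉q  = ⊥-elim (<⇒≱ (p⊂q⇒∣p∣<∣q∣ p∩q⊂p) ∣p∣≤∣p∩q∣)
  where
  p∩q⊂p : p ∩ q ⊂ p
  p∩q⊂p = p∩q⊆p p q , x , x∈p , λ x∈p∩q → x∉q (proj₂ (x∈p∩q⁻ p q x∈p∩q))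

triple : ∀ {n} → Subset n → Subset n → Subset n → Fin 3 → Subset n
triple a b c 0F = a
triple a b c 1F = b
triple a b c 2F = c

⋂ᶠ-triple : ∀ {n} (a b c : Subset n) → ⋂ᶠ (triple a b c) ≡ a ∩ b ∩ c
⋂ᶠ-triple a b c = cong (λ z → a ∩ b ∩ z) (∩-identityʳ c)

triple-injective : ∀ {n} {a b c : Subset n} → a ≢ b → a ≢ c → b ≢ c →
                   Injective _≡_ _≡_ (triple a b c)
triple-injective a≢b a≢c b≢c {0F} {0F} _ = refl
triple-injective a≢b a≢c b≢c {0F} {1F} e = ⊥-elim (a≢b e)
triple-injective a≢b a≢c b≢c {0F} {2F} e = ⊥-elim (a≢c e)
triple-injective a≢b a≢c b≢c {1F} {0F} e = ⊥-elim (a≢b (sym e))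
triple-injective a≢b a≢c b≢c {1F} {1F} _ = refl
triple-injective a≢b a≢c b≢c {1F} {2F} e = ⊥-elim (b≢c e)
triple-injective a≢b a≢c b≢c {2F} {0F} e = ⊥-elim (a≢c (sym e))
triple-injective a≢b a≢c b≢c {2F} {1F} e = ⊥-elim (b≢c (sym e))
triple-injective a≢b a≢c b≢c {2F} {2F} _ = refl

triple-all : ∀ {n ℓ} {P : Subset n → Set ℓ} {a b c : Subset n} →
             P a → P b → P c → ∀ j → P (triple a b c j)
triple-all Pa Pb Pc 0F = Pa
triple-all Pa Pb Pc 1F = Pb
triple-all Pa Pb Pc 2F = Pc

closed-triple : ∀ {n r p q} {F : Family n} {a b c : Subset n} →
                RClosedIntersecting r p q F → 3 ≤ r →
                F a → F b → F c → a ≢ b → a ≢ c → b ≢ c →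
                ∃ λ j → q * ∣ a ∩ b ∩ c ∣ ≡ p * ∣ triple a b c j ∣
closed-triple {q = q} {F = F} {a} {b} {c} closed 3≤r Fa Fb Fc a≢b a≢c b≢c =
  let j , q∣⋂∣≡p∣j∣ = closed 3 (s≤s (s≤s z≤n)) 3≤r (triple a b c)
                        (triple-injective a≢b a≢c b≢c) (triple-all {P = F} Fa Fb Fc)
  in j , trans (cong (λ z → q * ∣ z ∣) (sym (⋂ᶠ-triple a b c))) q∣⋂∣≡p∣j∣

closed-triple-≥ : ∀ {n r p q m} {F : Family n} {a b c : Subset n} →
                  RClosedIntersecting r p q F → 3 ≤ r →
                  F a → F b → F c → a ≢ b → a ≢ c → b ≢ c →
                  m ≤ ∣ a ∣ → m ≤ ∣ b ∣ → m ≤ ∣ c ∣ →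
                  p * m ≤ q * ∣ a ∩ b ∩ c ∣
closed-triple-≥ {p = p} {q} {m} {a = a} {b} {c} closed 3≤r Fa Fb Fc a≢b a≢c b≢c m≤a m≤b m≤c =
  let j , q∣a∩b∩c∣≡p∣j∣ = closed-triple {p = p} {q} closed 3≤r Fa Fb Fc a≢b a≢c b≢c in
  ≤-trans (*-monoʳ-≤ p (triple-all {P = λ x → m ≤ ∣ x ∣} m≤a m≤b m≤c j))
          (≤-reflexive (sym q∣a∩b∩c∣≡p∣j∣))

InTor⇒≢ : ∀ {n p q} {F : Family n} {A B : Subset n} →
          p < q → 0 < ∣ A ∣ → InTor p q F A B → A ≢ B
InTor⇒≢ {p = p} {q} {A = A} p<q 0<∣A∣ (_ , _ , q∣A∩B∣≡p∣A∣) refl =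
  <⇒≢ (*-monoˡ-< ∣ A ∣ {{>-nonZero 0<∣A∣}} p<q) (begin-equality
    p * ∣ A ∣      ≡⟨ sym q∣A∩B∣≡p∣A∣ ⟩
    q * ∣ A ∩ A ∣  ≡⟨ cong (λ z → q * ∣ z ∣) (∩-idem A) ⟩
    q * ∣ A ∣      ∎)
  where open ≤-Reasoning

core⊆larger : ∀ {n r p q} {F : Family n} {A B C : Subset n} →
              RClosedIntersecting r p q F → 3 ≤ r → p < q →
              F A → 0 < ∣ A ∣ → InTor p q F A B → F C → ∣ A ∣ < ∣ C ∣ →
              A ∩ B ⊆ C
core⊆larger {B = B} {C} _ _ _ _ _ _ _ _ with ≡-dec _≟ᵇ_ B C
core⊆larger {A = A} _ _ _ _ _ _ _ _ | yes refl = p∩q⊆q A _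
core⊆larger {p = p} {q} {F} {A} {B} {C} closed 3≤r p<q FA 0<∣A∣ A∼B@(FB , ∣A∣≤∣B∣ , q∣A∩B∣≡p∣A∣) FC ∣A∣<∣C∣
  | no B≢C = ∣p∣≤∣p∩q∣⇒p⊆q (A ∩ B) C (*-cancelˡ-≤ q {{>-nonZero (≤-<-trans z≤n p<q)}} (begin
    q * ∣ A ∩ B ∣        ≡⟨ q∣A∩B∣≡p∣A∣ ⟩
    p * ∣ A ∣            ≤⟨ closed-triple-≥ {p = p} {q} closed 3≤r FA FB FC A≢B A≢C B≢C ≤-refl ∣A∣≤∣B∣ (<⇒≤ ∣A∣<∣C∣) ⟩
    q * ∣ A ∩ B ∩ C ∣    ≡⟨ cong (λ z → q * ∣ z ∣) (sym (∩-assoc A B C)) ⟩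
    q * ∣ (A ∩ B) ∩ C ∣  ∎))
  where
  open ≤-Reasoning
  A≢B : A ≢ B
  A≢B = InTor⇒≢ {F = F} p<q 0<∣A∣ A∼B
  A≢C : A ≢ C
  A≢C A≡C = <⇒≢ ∣A∣<∣C∣ (cong ∣_∣ A≡C)

lemma2p18 : (n r p q : ℕ) (F : Family n) →
    3 ≤ r → 0 < p → p < q →
    RClosedIntersecting r p q F →
    (∃ λ j → InSnor p q F j) →
    (imax : ℕ) → IsMaxSnor p q F imax →
    (i : ℕ) → InSexc p q F i → imax < i →
    (A : Subset n) → IsSingletonLevel F i A →
    ∀ (A′ B : Subset n) → F A′ → ∣ A′ ∣ ≡ imax → InTor p q F A′ B →
    (A′ ∩ B) ⊆ A
lemma2p18 n r p q F 3≤r _ p<q closed _ imax (((1≤imax , _) , _) , _) i _ imax<i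
          A (FA , ∣A∣≡i , _) A′ B FA′ ∣A′∣≡imax A′∼B =
  core⊆larger {F = F} closed 3≤r p<q FA′ 0<∣A′∣ A′∼B FA ∣A′∣<∣A∣
  where
  0<∣A′∣ : 0 < ∣ A′ ∣
  0<∣A′∣ rewrite ∣A′∣≡imax = 1≤imax
  ∣A′∣<∣A∣ : ∣ A′ ∣ < ∣ A ∣
  ∣A′∣<∣A∣ rewrite ∣A′∣≡imax | ∣A∣≡i = imax<i
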